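{- Let $F$ be a $2$-cube of a layer-latin parallelepiped of size $2\times5\times2$. Then: (1) If $F$ has no transversal and its first layer is $\alpha\beta$, then its second layer is $\overline{\beta}\,\overline{\alpha}$. (2) If $F$ has no transversal, then every $2$-cube of the same parallelepiped adjacent to $F$ has $4$ transversals. (3) If $F$ has $4$ transversals all with the same range, then for some column $\alpha$ one layer of $F$ is $\alpha\overline{\alpha}$ and the other is $\overline{\alpha}\alpha$. (4) If $F$ has $4$ transversals and its cells contain $5$ different symbols, then the transversals of $F$ have at least $3$ different ranges. (5) If $F$ has $4$ transversals with two different ranges and the second columns of the two layers of $F$ are $\beta$ and $\overline{\beta}$ respectively, then either the layers of $F$ are $\alpha\beta$ and $\overline{\alpha}\,\overline{\beta}$ for some column $\alpha$, or, for some symbols $a,b,c$, one layer of $F$ is $\begin{array}{cc} b&a\\ a&b\end{array}$ and the other layer is $\begin{array}{cc} a&b\\ c&a\end{array}$ or $\begin{array}{cc} c&b\\ b&a\end{array}$.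
   Context: $Q_5=\{0,\dots,4\}$. A layer-latin parallelepiped of size $2\times5\times2$ is a pair of $2\times5$ arrays (its first and second layer) over $Q_5$ such that in each layer every row contains $5$ distinct symbols and every column contains $2$ distinct symbols (e.g. obtained by choosing two rows in each layer of a $2$-layer latin cuboid of order $5$). A column is written $\alpha=\binom{a}{b}$ (top entry $a$, bottom entry $b$) and $\overline{\alpha}=\binom{b}{a}$; a $2\times m$ array with columns $\alpha_1,\dots,\alpha_m$ is written $\alpha_1\cdots\alpha_m$. A $2$-cube of the parallelepiped is the $2\times2\times2$ array obtained by keeping the same two column positions in both layers (columns kept in their order); two distinct $2$-cubes are adjacent if they share a column position. A diagonal of a $2$-cube is a pair of its cells differing in all three coordinates (layer, row, column), so a $2$-cube has $4$ diagonals; a transversal is a diagonal whose two cells have different symbols, and its range is the set of these two symbols. -}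

module Defs where

open import Data.Fin using (Fin; zero; suc; _<_)
open import Data.Fin.Subset using (Subset; ⁅_⁆; _∪_; ∣_∣)
open import Data.Product using (_×_; _,_; proj₁; proj₂; Σ; ∃; ∃-syntax)
open import Data.Sum using (_⊎_)
open import Data.Nat using (ℕ)
open import Function.Definitions using (Injective)
open import Relation.Binary.PropositionalEquality using (_≡_; _≢_)
open import Relation.Nullary using (¬_)

Q₅ : Set
Q₅ = Fin 5

-- a column (top entry , bottom entry)
Column : Set
Column = Q₅ × Q₅

bar : Column → Column
bar (a , b) = (b , a)

-- the 2×2 array  α β  (first column α, second column β)
Layer₂ : Set
Layer₂ = Column × Column

-- A 2×5×2 parallelepiped: P layer row column
Para : Set
Para = Fin 2 → Fin 2 → Fin 5 → Q₅

LayerLatin : Para → Set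
LayerLatin P =
  (∀ l r → Injective _≡_ _≡_ (P l r)) ×
  (∀ l k → P l zero k ≢ P l (suc zero) k)

colAt : Para → Fin 2 → Fin 5 → Column
colAt P l k = (P l zero k , P l (suc zero) k)

Cube : Set
Cube = Layer₂ × Layer₂

cubeAt : Para → Fin 5 → Fin 5 → Cube
cubeAt P i j = ((colAt P zero i , colAt P zero j) , (colAt P (suc zero) i , colAt P (suc zero) j))

layer : Cube → Fin 2 → Layer₂
layer F zero = proj₁ F
layer F (suc zero) = proj₂ F

colOf : Layer₂ → Fin 2 → Column
colOf L zero = proj₁ L
colOf L (suc zero) = proj₂ L

entry : Column → Fin 2 → Q₅
entry α zero = proj₁ α
entry α (suc zero) = proj₂ α

cell : Cube → Fin 2 → Fin 2 → Fin 2 → Q₅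
cell F l r c = entry (colOf (layer F l) c) r

flip : Fin 2 → Fin 2
flip zero = suc zero
flip (suc zero) = zero

-- The 4 diagonals of a 2-cube are indexed by (r , c): the diagonal
-- {(layer 0, row r, col c), (layer 1, row flip r, col flip c)}.
Diag : Set
Diag = Fin 2 × Fin 2

diagEnds : Cube → Diag → Q₅ × Q₅
diagEnds F (r , c) = (cell F zero r c , cell F (suc zero) (flip r) (flip c))

IsTransversal : Cube → Diag → Set
IsTransversal F d = proj₁ (diagEnds F d) ≢ proj₂ (diagEnds F d)

range : Cube → Diag → Subset 5
range F d = ⁅ proj₁ (diagEnds F d) ⁆ ∪ ⁅ proj₂ (diagEnds F d) ⁆

NoTransversal : Cube → Set
NoTransversal F = ∀ d → ¬ IsTransversal F d

FourTransversals : Cube → Set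
FourTransversals F = ∀ d → IsTransversal F d

symbols : Cube → Subset 5
symbols F =
  (⁅ cell F zero zero zero ⁆ ∪ ⁅ cell F zero zero (suc zero) ⁆ ∪
   ⁅ cell F zero (suc zero) zero ⁆ ∪ ⁅ cell F zero (suc zero) (suc zero) ⁆) ∪
  (⁅ cell F (suc zero) zero zero ⁆ ∪ ⁅ cell F (suc zero) zero (suc zero) ⁆ ∪
   ⁅ cell F (suc zero) (suc zero) zero ⁆ ∪ ⁅ cell F (suc zero) (suc zero) (suc zero) ⁆)

ExactlyTwoRanges : Cube → Set
ExactlyTwoRanges F =
  Σ Diag λ d → Σ Diag λ d' → range F d ≢ range F d' ×
    (∀ e → range F e ≡ range F d ⊎ range F e ≡ range F d')

AtLeastThreeRanges : Cube → Set
AtLeastThreeRanges F =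
  Σ Diag λ d₁ → Σ Diag λ d₂ → Σ Diag λ d₃ →
    range F d₁ ≢ range F d₂ × range F d₁ ≢ range F d₃ × range F d₂ ≢ range F d₃

-- the 2×2 array with rows (x y) and (z w), as a pair of columns
arr : Q₅ → Q₅ → Q₅ → Q₅ → Layer₂
arr x y z w = ((x , z) , (y , w))

Adjacent : Fin 5 → Fin 5 → Fin 5 → Fin 5 → Set
Adjacent i j i' j' =
  ¬ (i ≡ i' × j ≡ j') × (i ≡ i' ⊎ i ≡ j' ⊎ j ≡ i' ⊎ j ≡ j')

-- A diagonal without transversal identifies its two cells: this gives (1) at once, and
-- in (2) it identifies each column of one layer with a column of the other; injectivity of the
-- rows then forbids a repeated symbol on every diagonal of an adjacent cube. Every cell is an end
-- of exactly one diagonal, so the symbols of a cube lie in the union of the ranges; five symbols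
-- do not fit into two ranges of size at most 2, which gives (4). For (3) and (5), equality of
-- two ranges {x,y} = {u,v} with x ≠ y means x,y match u,v straight or crossed; the latin
-- conditions leave only one matching, and the resulting symbol equalities produce the shapes.
module Submission where

open import Defs
open import Data.Bool using () renaming (_≟_ to _≟ᵇ_)
open import Data.Empty using (⊥-elim)
open import Data.Fin using (Fin; zero; suc; _<_; _≟_)
open import Data.Fin.Properties using (<-irrefl; <-trans; <⇒≢; all?; ¬∀⟶∃¬)
open import Data.Fin.Subset using (Subset; ⁅_⁆; _∪_; _∈_; _⊆_; ∣_∣; inside; outside)
open import Data.Fin.Subset.Properties
  using (x∈⁅x⁆; x∈⁅y⁆⇒x≡y; x∈p∪q⁻; p⊆p∪q; q⊆p∪q; ⊆-trans; ⊆-reflexive; p⊆q⇒∣p∣≤∣q∣; ∣⁅x⁆∣≡1; ∣p∣≤∣x∷p∣)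
open import Data.Nat using (_≤_; _+_; z≤n; s≤s)
open import Data.Nat.Properties using (1+n≰n; module ≤-Reasoning; ≤-trans; ≤-reflexive; +-monoʳ-≤; +-mono-≤; +-suc)
open import Data.Product using (_×_; _,_; proj₁; proj₂; Σ; ∃)
open import Data.Sum using (_⊎_; inj₁; inj₂; [_,_]; [_,_]′)
import Data.Sum as Sum
open import Data.Vec using (_∷_; [])
open import Data.Vec.Properties using (≡-dec)
open import Function using (_∘_; id)
open import Function.Definitions using (Injective)
open import Relation.Binary.Definitions using (DecidableEquality)
open import Relation.Binary.PropositionalEquality using (_≡_; _≢_; refl; sym; trans; cong₂; subst; ≢-sym)
open import Relation.Nullary using (¬_; Dec; yes; no)
open import Relation.Nullary.Decidable using (decidable-stable; _⊎-dec_)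

∪-⊆ : ∀ {n} {p q r : Subset n} → p ⊆ r → q ⊆ r → p ∪ q ⊆ r
∪-⊆ p⊆r q⊆r x∈p∪q = [ p⊆r , q⊆r ] (x∈p∪q⁻ _ _ x∈p∪q)

∣p∪q∣≤∣p∣+∣q∣ : ∀ {n} (p q : Subset n) → ∣ p ∪ q ∣ ≤ ∣ p ∣ + ∣ q ∣
∣p∪q∣≤∣p∣+∣q∣ [] [] = z≤n
∣p∪q∣≤∣p∣+∣q∣ (inside ∷ p) (x ∷ q) =
  s≤s (≤-trans (∣p∪q∣≤∣p∣+∣q∣ p q) (+-monoʳ-≤ ∣ p ∣ (∣p∣≤∣x∷p∣ x q)))
∣p∪q∣≤∣p∣+∣q∣ (outside ∷ p) (inside ∷ q) =
  ≤-trans (s≤s (∣p∪q∣≤∣p∣+∣q∣ p q)) (≤-reflexive (sym (+-suc ∣ p ∣ ∣ q ∣)))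
∣p∪q∣≤∣p∣+∣q∣ (outside ∷ p) (outside ∷ q) = ∣p∪q∣≤∣p∣+∣q∣ p q

∣⁅x⁆∪⁅y⁆∣≤2 : ∀ {n} (x y : Fin n) → ∣ ⁅ x ⁆ ∪ ⁅ y ⁆ ∣ ≤ 2
∣⁅x⁆∪⁅y⁆∣≤2 x y =
  ≤-trans (∣p∪q∣≤∣p∣+∣q∣ ⁅ x ⁆ ⁅ y ⁆) (≤-reflexive (cong₂ _+_ (∣⁅x⁆∣≡1 x) (∣⁅x⁆∣≡1 y)))

x∈⁅y⁆∪⁅z⁆⁻ : ∀ {n} {x y z : Fin n} → x ∈ ⁅ y ⁆ ∪ ⁅ z ⁆ → x ≡ y ⊎ x ≡ z
x∈⁅y⁆∪⁅z⁆⁻ {y = y} {z} x∈ with x∈p∪q⁻ ⁅ y ⁆ ⁅ z ⁆ x∈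
... | inj₁ x∈⁅y⁆ = inj₁ (x∈⁅y⁆⇒x≡y y x∈⁅y⁆)
... | inj₂ x∈⁅z⁆ = inj₂ (x∈⁅y⁆⇒x≡y z x∈⁅z⁆)

⁅x⁆∪⁅y⁆-injective : ∀ {n} {x y u v : Fin n} → x ≢ y → ⁅ x ⁆ ∪ ⁅ y ⁆ ≡ ⁅ u ⁆ ∪ ⁅ v ⁆ →
  (x ≡ u × y ≡ v) ⊎ (x ≡ v × y ≡ u)
⁅x⁆∪⁅y⁆-injective {x = x} {y} x≢y eq
  with x∈⁅y⁆∪⁅z⁆⁻ (subst (x ∈_) eq (p⊆p∪q ⁅ y ⁆ (x∈⁅x⁆ x)))
     | x∈⁅y⁆∪⁅z⁆⁻ (subst (y ∈_) eq (q⊆p∪q ⁅ x ⁆ ⁅ y ⁆ (x∈⁅x⁆ y)))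
... | inj₁ x≡u | inj₁ y≡u = ⊥-elim (x≢y (trans x≡u (sym y≡u)))
... | inj₁ x≡u | inj₂ y≡v = inj₁ (x≡u , y≡v)
... | inj₂ x≡v | inj₁ y≡u = inj₂ (x≡v , y≡u)
... | inj₂ x≡v | inj₂ y≡v = ⊥-elim (x≢y (trans x≡v (sym y≡v)))

pair-shared : ∀ {n} {x y z : Fin n} → x ≢ y → ⁅ x ⁆ ∪ ⁅ y ⁆ ≡ ⁅ y ⁆ ∪ ⁅ z ⁆ → x ≡ z
pair-shared x≢y eq = [ ⊥-elim ∘ x≢y ∘ proj₁ , proj₁ ] (⁅x⁆∪⁅y⁆-injective x≢y eq)

pair-straight : ∀ {n} {x y u v : Fin n} → x ≢ y → y ≢ u →
  ⁅ x ⁆ ∪ ⁅ y ⁆ ≡ ⁅ u ⁆ ∪ ⁅ v ⁆ → x ≡ u × y ≡ v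
pair-straight x≢y y≢u eq = [ id , ⊥-elim ∘ y≢u ∘ proj₂ ] (⁅x⁆∪⁅y⁆-injective x≢y eq)

pair-crossed : ∀ {n} {x y u v : Fin n} → x ≢ y → x ≢ u →
  ⁅ x ⁆ ∪ ⁅ y ⁆ ≡ ⁅ u ⁆ ∪ ⁅ v ⁆ → x ≡ v × y ≡ u
pair-crossed x≢y x≢u eq = [ ⊥-elim ∘ x≢u ∘ proj₁ , id ] (⁅x⁆∪⁅y⁆-injective x≢y eq)

_≟ˢ_ : ∀ {n} → DecidableEquality (Subset n)
_≟ˢ_ = ≡-dec _≟ᵇ_

D₀₀ D₀₁ D₁₀ D₁₁ : Diag
D₀₀ = zero , zero
D₀₁ = zero , suc zero
D₁₀ = suc zero , zero
D₁₁ = suc zero , suc zero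

ThreeDistinct : {A : Set} → (Diag → A) → Set
ThreeDistinct f = Σ Diag λ d₁ → Σ Diag λ d₂ → Σ Diag λ d₃ →
  f d₁ ≢ f d₂ × f d₁ ≢ f d₃ × f d₂ ≢ f d₃

CoveredByTwo : {A : Set} → (Diag → A) → Set
CoveredByTwo f = Σ Diag λ d → Σ Diag λ d' → ∀ e → f e ≡ f d ⊎ f e ≡ f d'

∀⊎∃¬ : {P : Diag → Set} → (∀ d → Dec (P d)) → (∀ d → P d) ⊎ ∃ λ d → ¬ P d
∀⊎∃¬ P? with all? (λ r → all? (λ c → P? (r , c)))
... | yes ∀P = inj₁ λ (r , c) → ∀P r c
... | no ¬∀P =
  let r , ¬∀Pr = ¬∀⟶∃¬ 2 _ (λ r → all? (λ c → P? (r , c))) ¬∀P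
      c , ¬Prc = ¬∀⟶∃¬ 2 _ (λ c → P? (r , c)) ¬∀Pr
  in inj₂ ((r , c) , ¬Prc)

threeDistinct⊎coveredByTwo : {A : Set} → DecidableEquality A → (f : Diag → A) →
  ThreeDistinct f ⊎ CoveredByTwo f
threeDistinct⊎coveredByTwo _≟ᴬ_ f with ∀⊎∃¬ (λ e → f e ≟ᴬ f D₀₀)
... | inj₁ all≡ = inj₂ (D₀₀ , D₀₀ , inj₁ ∘ all≡)
... | inj₂ (d , fd≢fd₀) with ∀⊎∃¬ (λ e → f e ≟ᴬ f D₀₀ ⊎-dec f e ≟ᴬ f d)
...   | inj₁ covered = inj₂ (D₀₀ , d , covered)
...   | inj₂ (e , uncovered) =
  inj₁ (D₀₀ , d , e , ≢-sym fd≢fd₀ , uncovered ∘ inj₁ ∘ sym , uncovered ∘ inj₂ ∘ sym)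

coveredByTwo⇒twoOfThreeEqual : {A : Set} {f : Diag → A} → CoveredByTwo f →
  ∀ d₁ d₂ d₃ → f d₁ ≡ f d₂ ⊎ f d₁ ≡ f d₃ ⊎ f d₂ ≡ f d₃
coveredByTwo⇒twoOfThreeEqual (_ , _ , cover) d₁ d₂ d₃ with cover d₁ | cover d₂ | cover d₃
... | inj₁ p | inj₁ q | _      = inj₁ (trans p (sym q))
... | inj₂ p | inj₂ q | _      = inj₁ (trans p (sym q))
... | inj₁ p | inj₂ _ | inj₁ r = inj₂ (inj₁ (trans p (sym r)))
... | inj₂ p | inj₁ _ | inj₂ r = inj₂ (inj₁ (trans p (sym r)))
... | inj₁ _ | inj₂ q | inj₂ r = inj₂ (inj₂ (trans q (sym r)))
... | inj₂ _ | inj₁ q | inj₁ r = inj₂ (inj₂ (trans q (sym r)))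

Latin₂ : Layer₂ → Set
Latin₂ ((a , c) , (b , d)) = a ≢ b × c ≢ d × a ≢ c × b ≢ d

LatinCube : Cube → Set
LatinCube (L₀ , L₁) = Latin₂ L₀ × Latin₂ L₁

cubeAt-latin : ∀ {P} → LayerLatin P → ∀ {i j} → i ≢ j → LatinCube (cubeAt P i j)
cubeAt-latin (rowInj , colDistinct) {i} {j} i≢j =
  (i≢j ∘ rowInj zero zero , i≢j ∘ rowInj zero (suc zero) ,
   colDistinct zero i , colDistinct zero j) ,
  (i≢j ∘ rowInj (suc zero) zero , i≢j ∘ rowInj (suc zero) (suc zero) ,
   colDistinct (suc zero) i , colDistinct (suc zero) j)

noTransversal⇒endsEqual : ∀ {F} → NoTransversal F → ∀ d →
  proj₁ (diagEnds F d) ≡ proj₂ (diagEnds F d)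
noTransversal⇒endsEqual noT d = decidable-stable (_ ≟ _) (noT d)

noTransversal⇒layer₁≡bars : (F : Cube) → NoTransversal F → (α β : Column) →
  layer F zero ≡ (α , β) → layer F (suc zero) ≡ (bar β , bar α)
noTransversal⇒layer₁≡bars (_ , ((e , g) , (f , h))) noT (a , c) (b , d) refl
  with noTransversal⇒endsEqual noT D₀₀ | noTransversal⇒endsEqual noT D₀₁
     | noTransversal⇒endsEqual noT D₁₀ | noTransversal⇒endsEqual noT D₁₁
... | refl | refl | refl | refl = refl

allRangesEqual⇒layers≡α,ᾱ : (F : Cube) → LatinCube F → FourTransversals F →
  (∀ d d' → range F d ≡ range F d') →
  Σ Column λ α →
    (layer F zero ≡ (α , bar α) × layer F (suc zero) ≡ (bar α , α)) ⊎
    (layer F (suc zero) ≡ (α , bar α) × layer F zero ≡ (bar α , α))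
allRangesEqual⇒layers≡α,ᾱ (((a , c) , (b , d)) , ((e , g) , (f , h)))
  ((a≢b , _ , a≢c , b≢d) , _) four same
  with ⁅x⁆∪⁅y⁆-injective (four D₀₁) (same D₀₁ D₀₀)
     | ⁅x⁆∪⁅y⁆-injective (four D₁₀) (same D₁₀ D₀₀)
     | ⁅x⁆∪⁅y⁆-injective (four D₁₁) (same D₁₁ D₀₀)
... | inj₁ (b≡a , _) | _ | _ = ⊥-elim (a≢b (sym b≡a))
... | _ | inj₁ (c≡a , _) | _ = ⊥-elim (a≢c (sym c≡a))
... | inj₂ (b≡h , _) | _ | inj₂ (d≡h , _) = ⊥-elim (b≢d (trans b≡h (sym d≡h)))
... | inj₂ (refl , refl) | inj₂ (refl , refl) | inj₁ (refl , refl) = _ , inj₁ (refl , refl)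

symbols⊆ : (F : Cube) {X : Subset 5} → (∀ d → range F d ⊆ X) → symbols F ⊆ X
symbols⊆ F ranges⊆X =
  ∪-⊆ (∪-⊆ (end₁ D₀₀) (∪-⊆ (end₁ D₀₁) (∪-⊆ (end₁ D₁₀) (end₁ D₁₁))))
      (∪-⊆ (end₂ D₁₁) (∪-⊆ (end₂ D₁₀) (∪-⊆ (end₂ D₀₁) (end₂ D₀₀))))
  where
  end₁ : ∀ d → ⁅ proj₁ (diagEnds F d) ⁆ ⊆ _
  end₁ d = ⊆-trans (p⊆p∪q _) (ranges⊆X d)
  end₂ : ∀ d → ⁅ proj₂ (diagEnds F d) ⁆ ⊆ _
  end₂ d = ⊆-trans (q⊆p∪q _ _) (ranges⊆X d)

coveredByTwo⇒∣symbols∣≤4 : (F : Cube) → CoveredByTwo (range F) → ∣ symbols F ∣ ≤ 4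
coveredByTwo⇒∣symbols∣≤4 F (d , d' , cover) = begin
  ∣ symbols F ∣                    ≤⟨ p⊆q⇒∣p∣≤∣q∣ (symbols⊆ F range⊆) ⟩
  ∣ range F d ∪ range F d' ∣       ≤⟨ ∣p∪q∣≤∣p∣+∣q∣ (range F d) (range F d') ⟩
  ∣ range F d ∣ + ∣ range F d' ∣   ≤⟨ +-mono-≤ (∣range∣≤2 d) (∣range∣≤2 d') ⟩
  4                                ∎
  where
  open ≤-Reasoning
  ∣range∣≤2 : ∀ e → ∣ range F e ∣ ≤ 2
  ∣range∣≤2 e = ∣⁅x⁆∪⁅y⁆∣≤2 (proj₁ (diagEnds F e)) (proj₂ (diagEnds F e))
  range⊆ : ∀ e → range F e ⊆ range F d ∪ range F d'
  range⊆ e = [ (λ eq → ⊆-trans (⊆-reflexive eq) (p⊆p∪q _))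
             , (λ eq → ⊆-trans (⊆-reflexive eq) (q⊆p∪q _ _)) ] (cover e)

∣symbols∣≡5⇒atLeastThreeRanges : (F : Cube) → ∣ symbols F ∣ ≡ 5 → AtLeastThreeRanges F
∣symbols∣≡5⇒atLeastThreeRanges F ∣symbols∣≡5 with threeDistinct⊎coveredByTwo _≟ˢ_ (range F)
... | inj₁ three = three
... | inj₂ two   = ⊥-elim (1+n≰n (subst (_≤ 4) ∣symbols∣≡5 (coveredByTwo⇒∣symbols∣≤4 F two)))

coveredByTwo⇒layers : (F : Cube) → LatinCube F → CoveredByTwo (range F) → (β : Column) →
  proj₂ (layer F zero) ≡ β → proj₂ (layer F (suc zero)) ≡ bar β →
  (Σ Column λ α → layer F zero ≡ (α , β) × layer F (suc zero) ≡ (bar α , bar β)) ⊎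
  (Σ Q₅ λ a → Σ Q₅ λ b → Σ Q₅ λ c → Σ (Fin 2) λ l →
    layer F l ≡ arr b a a b ×
    (layer F (flip l) ≡ arr a b c a ⊎ layer F (flip l) ≡ arr c b b a))
-- Once the second columns are (b , d) and (d , b), the ranges are {a,b}, {b,g}, {c,d}, {d,e};
-- a = g and c = e give the first alternative, otherwise two of any three ranges coincide.
coveredByTwo⇒layers (((a , c) , (b , d)) , ((e , g) , (f , h)))
  ((a≢b , c≢d , a≢c , b≢d) , (_ , g≢h , _ , _)) two _ refl refl with a ≟ g
... | yes refl with c ≟ e
...   | yes refl = inj₁ (_ , refl , refl)
...   | no c≢e
      with Sum.map (pair-crossed a≢b a≢c)
                   [ pair-straight a≢b b≢d , ⊥-elim ∘ c≢e ∘ pair-shared c≢d ]′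
                   (coveredByTwo⇒twoOfThreeEqual two D₀₀ D₁₀ D₁₁)
...     | inj₁ (refl , refl) = inj₂ (_ , _ , _ , zero , refl , inj₂ refl)
...     | inj₂ (refl , refl) = inj₂ (_ , _ , _ , suc zero , refl , inj₁ refl)
coveredByTwo⇒layers (((a , c) , (b , d)) , ((e , g) , (f , h)))
  ((a≢b , c≢d , a≢c , b≢d) , (_ , g≢h , _ , _)) two _ refl refl | no a≢g
  with [ ⊥-elim ∘ a≢g ∘ pair-shared a≢b
       , Sum.map (pair-crossed a≢b a≢c) (pair-straight c≢d (≢-sym b≢d) ∘ sym) ]′
       (coveredByTwo⇒twoOfThreeEqual two D₀₀ D₀₁ D₁₀)
     | [ ⊥-elim ∘ a≢g ∘ pair-shared a≢b
       , Sum.map (pair-straight a≢b b≢d) (pair-crossed (≢-sym g≢h) b≢d) ]′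
       (coveredByTwo⇒twoOfThreeEqual two D₀₀ D₀₁ D₁₁)
... | inj₁ (refl , refl) | inj₁ (refl , refl) = inj₂ (_ , _ , _ , zero , refl , inj₁ refl)
... | inj₂ (refl , refl) | inj₂ (refl , refl) = inj₂ (_ , _ , _ , suc zero , refl , inj₂ refl)
... | inj₁ (a≡d , _) | inj₂ (_ , g≡d) = ⊥-elim (a≢g (trans a≡d (sym g≡d)))
... | inj₂ (_ , d≡g) | inj₁ (a≡d , _) = ⊥-elim (a≢g (trans a≡d d≡g))

module _ {P : Para} where

  Linked : Fin 5 → Fin 5 → Set
  Linked k k' = ∀ r → P zero r k ≡ P (suc zero) (flip r) k'

  Unlinked : Fin 5 → Fin 5 → Set
  Unlinked k k' = ∀ r → P zero r k ≢ P (suc zero) (flip r) k'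

  noTransversal⇒linked : ∀ {i j} → NoTransversal (cubeAt P i j) → Linked i j × Linked j i
  noTransversal⇒linked noT =
    (λ { zero → constant D₀₀ ; (suc zero) → constant D₁₀ }) ,
    (λ { zero → constant D₀₁ ; (suc zero) → constant D₁₁ })
    where constant = noTransversal⇒endsEqual noT

  unlinked⇒fourTransversals : ∀ {i j} → Unlinked i j → Unlinked j i → FourTransversals (cubeAt P i j)
  unlinked⇒fourTransversals u u' (zero , zero) = u zero
  unlinked⇒fourTransversals u u' (zero , suc zero) = u' zero
  unlinked⇒fourTransversals u u' (suc zero , zero) = u (suc zero)
  unlinked⇒fourTransversals u u' (suc zero , suc zero) = u' (suc zero)

  module _ (rowInjective : ∀ l r → Injective _≡_ _≡_ (P l r)) where

    linked⇒unlinked : ∀ {s t m} → Linked s t → Linked t s → m ≢ t → Unlinked s m × Unlinked m s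
    linked⇒unlinked st ts m≢t =
      (λ r eq → m≢t (sym (rowInjective (suc zero) (flip r) (trans (sym (st r)) eq)))) ,
      (λ r eq → m≢t (rowInjective zero r (trans eq (sym (ts r)))))

    linked⇒fourTransversals : ∀ {s t m} → Linked s t → Linked t s → m ≢ t →
      FourTransversals (cubeAt P s m) × FourTransversals (cubeAt P m s)
    linked⇒fourTransversals st ts m≢t =
      let sm , ms = linked⇒unlinked st ts m≢t
      in unlinked⇒fourTransversals sm ms , unlinked⇒fourTransversals ms sm

    noTransversal⇒adjacent-fourTransversals : ∀ {i j i' j'} → i < j → i' < j' →
      NoTransversal (cubeAt P i j) → Adjacent i j i' j' → FourTransversals (cubeAt P i' j')
    noTransversal⇒adjacent-fourTransversals i<j i'<j' noT (distinct , shared)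
      with shared | noTransversal⇒linked noT
    ... | inj₁ refl | ij , ji =
      proj₁ (linked⇒fourTransversals ij ji (λ j'≡j → distinct (refl , sym j'≡j)))
    ... | inj₂ (inj₁ refl) | ij , ji =
      proj₂ (linked⇒fourTransversals ij ji (λ { refl → <-irrefl refl (<-trans i'<j' i<j) }))
    ... | inj₂ (inj₂ (inj₁ refl)) | ij , ji =
      proj₁ (linked⇒fourTransversals ji ij (λ { refl → <-irrefl refl (<-trans i<j i'<j') }))
    ... | inj₂ (inj₂ (inj₂ refl)) | ij , ji =
      proj₂ (linked⇒fourTransversals ji ij (λ i'≡i → distinct (sym i'≡i , refl)))

proposition8 : (P : Para) → LayerLatin P → (i j : Fin 5) → i < j →
    let F = cubeAt P i j in
    (NoTransversal F → (α β : Column) → layer F zero ≡ (α , β) →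
      layer F (suc zero) ≡ (bar β , bar α)) ×
    (NoTransversal F → (i' j' : Fin 5) → i' < j' → Adjacent i j i' j' →
      FourTransversals (cubeAt P i' j')) ×
    (FourTransversals F → (∀ d d' → range F d ≡ range F d') →
      Σ Column λ α →
        (layer F zero ≡ (α , bar α) × layer F (suc zero) ≡ (bar α , α)) ⊎
        (layer F (suc zero) ≡ (α , bar α) × layer F zero ≡ (bar α , α))) ×
    (FourTransversals F → ∣ symbols F ∣ ≡ 5 → AtLeastThreeRanges F) ×
    (FourTransversals F → ExactlyTwoRanges F → (β : Column) →
      proj₂ (layer F zero) ≡ β → proj₂ (layer F (suc zero)) ≡ bar β →
      (Σ Column λ α → layer F zero ≡ (α , β) × layer F (suc zero) ≡ (bar α , bar β)) ⊎
      (Σ Q₅ λ a → Σ Q₅ λ b → Σ Q₅ λ c → Σ (Fin 2) λ l →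
        layer F l ≡ arr b a a b ×
        (layer F (flip l) ≡ arr a b c a ⊎ layer F (flip l) ≡ arr c b b a)))
proposition8 P latin@(rowInjective , _) i j i<j =
  noTransversal⇒layer₁≡bars F ,
  (λ noT i' j' i'<j' → noTransversal⇒adjacent-fourTransversals rowInjective i<j i'<j' noT) ,
  allRangesEqual⇒layers≡α,ᾱ F latinF ,
  (λ _ → ∣symbols∣≡5⇒atLeastThreeRanges F) ,
  (λ { _ (d , d' , _ , cover) → coveredByTwo⇒layers F latinF (d , d' , cover) })
  where
  F = cubeAt P i j
  latinF = cubeAt-latin latin (<⇒≢ i<j)
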